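{- Let $k$ be a positive odd integer, $d\ge2$, and $P(k,d)=\mathrm{Conv}\{\pm e_1,\dots,\pm e_{d-1},\pm\frac k2e_d\}\subseteq\mathbb R^d$. Let $G=\{1,\sigma\}$ act on $\mathbb Z^d$ by $\sigma(e_d)=-e_d$, $\sigma(e_j)=e_j$ for $j\ne d$. Then the equivariant $H^\ast$-series of $P(k,d)$ is $H^\ast[t]=\sum_{j=0}^d(a_j\chi_1+b_j\chi_2)t^j$, where \[a_j=\binom{d-2}{j}+\frac12(k+1)\binom{d-1}{j-1},\qquad b_j=\frac12(k-1)\binom{d-1}{j-1}-\binom{d-2}{j-1},\] with $\binom{n}{m}=0$ if $m<0$ or $m>n$.
   Context: For $g\in G$ let $A_g$ be the $d\times d$ matrix of $g$, $P^g=P(k,d)\cap\{x:A_gx=x\}$, and $\mathrm{ehr}(Q,t)=\sum_{m\ge0}|mQ\cap\mathbb Z^d|t^m$. The equivariant $H^\ast$-series is the power series $H^\ast[t]$ with coefficients in the representation ring $R(G)$ (virtual characters) determined by $H^\ast[t](g)=\mathrm{ehr}(P^g,t)\,(1-t)\det(I-tA_g)$ for $g\in G$. $\chi_1$ and $\chi_2$ are the trivial and non-trivial irreducible characters of $G$. -}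

module Defs where

open import Data.Nat as ℕ using (ℕ; zero; suc)
open import Data.Nat.Combinatorics using (_C_)
open import Data.Integer as ℤ using (ℤ; +_; -_; _+_; _*_; _-_; ∣_∣; 0ℤ; 1ℤ)
open import Data.Fin using (Fin; toℕ)
open import Data.Vec as Vec using (Vec; []; _∷_; lookup; zipWith; tabulate)
open import Data.Vec.Properties using (≡-dec)
open import Data.List as List using (List; []; _∷_; concatMap; filter; length; upTo; applyUpTo)
open import Data.Bool using (Bool; true; false; if_then_else_)
open import Relation.Binary.PropositionalEquality using (_≡_)
open import Relation.Nullary.Decidable using (Dec; yes; no; _×-dec_)

data G : Set where
  one σ : G

isLast : {d : ℕ} → Fin d → Bool
isLast {d} i = suc (toℕ i) ℕ.≡ᵇ d

diagA : (d : ℕ) → G → Vec ℤ d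
diagA d one = tabulate (λ _ → 1ℤ)
diagA d σ   = tabulate (λ i → if isLast i then - 1ℤ else 1ℤ)

act : {d : ℕ} → G → Vec ℤ d → Vec ℤ d
act {d} g x = zipWith _*_ (diagA d g) x

-- P(k,d) = Conv{±e_1,…,±e_{d-1},±(k/2)e_d} is the unit ball of the norm
--   |x_1|+…+|x_{d-1}| + (2/k)|x_d|,
-- so x ∈ m·P(k,d) iff  k(|x_1|+…+|x_{d-1}|) + 2|x_d| ≤ k·m.

weight : (k : ℕ) {d : ℕ} → Fin d → ℕ
weight k i = if isLast i then 2 else k

wnorm : (k : ℕ) {d : ℕ} → Vec ℤ d → ℕ
wnorm k {d} x = Vec.sum (tabulate (λ i → weight k i ℕ.* ∣ lookup x i ∣))

inDilate : (k d m : ℕ) → Vec ℤ d → Set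
inDilate k d m x = wnorm k x ℕ.≤ k ℕ.* m

inDilate? : (k d m : ℕ) (x : Vec ℤ d) → Dec (inDilate k d m x)
inDilate? k d m x = wnorm k x ℕ.≤? k ℕ.* m

range : ℕ → List ℤ
range B = List.map (λ i → + i - + B) (upTo (suc (B ℕ.+ B)))

box : (d : ℕ) → ℕ → List (Vec ℤ d)
box zero    B = [] ∷ []
box (suc d) B = concatMap (λ z → List.map (z ∷_) (box d B)) (range B)

inDilateFix : (k d m : ℕ) (g : G) → Vec ℤ d → Set
inDilateFix k d m g x = inDilate k d m x Data.Product.× (act g x ≡ x)
  where import Data.Product

-- |m·P^g ∩ ℤ^d|, where P^g = P(k,d) ∩ {x : A_g x = x}.
-- Every such point has |x_i| ≤ k·m (k ≥ 1), so it lies in the box [-km,km]^d.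
latticeCount : (k d : ℕ) (g : G) → ℕ → ℕ
latticeCount k d g m =
  length (filter (λ x → inDilate? k d m x ×-dec ≡-dec ℤ._≟_ (act g x) x)
                 (box d (k ℕ.* m)))

Poly : Set
Poly = List ℤ

coeff : Poly → ℕ → ℤ
coeff []       _       = 0ℤ
coeff (c ∷ cs) zero    = c
coeff (c ∷ cs) (suc n) = coeff cs n

polyAdd : Poly → Poly → Poly
polyAdd [] q = q
polyAdd p [] = p
polyAdd (a ∷ p) (b ∷ q) = (a + b) ∷ polyAdd p q

polyMul : Poly → Poly → Poly
polyMul []      q = []
polyMul (a ∷ p) q = polyAdd (List.map (a *_) q) (0ℤ ∷ polyMul p q)

polyProd : List Poly → Poly
polyProd = List.foldr polyMul (1ℤ ∷ [])

detIminusTA : {d : ℕ} → Vec ℤ d → Poly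
detIminusTA a = polyProd (Vec.toList (Vec.map (λ ai → 1ℤ ∷ (- ai) ∷ []) a))

multiplier : (d : ℕ) → G → Poly
multiplier d g = polyMul (1ℤ ∷ - 1ℤ ∷ []) (detIminusTA (diagA d g))

polyTimesSeries : Poly → (ℕ → ℤ) → ℕ → ℤ
polyTimesSeries p f n = List.foldr _+_ 0ℤ (List.map (λ i → coeff p i * f (n ℕ.∸ i)) (upTo (suc n)))

HstarAt : (k d : ℕ) → G → ℕ → ℤ
HstarAt k d g = polyTimesSeries (multiplier d g) (λ m → + latticeCount k d g m)

χ₁ χ₂ : G → ℤ
χ₁ _   = 1ℤ
χ₂ one = 1ℤ
χ₂ σ   = - 1ℤ

-- binomial with the convention (n choose m) = 0 for m < 0 or m > n;
-- binomPred n j = (n choose (j - 1))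
binom : ℕ → ℕ → ℤ
binom n m = + (n C m)

binomPred : ℕ → ℕ → ℤ
binomPred n zero    = 0ℤ
binomPred n (suc j) = binom n j

-- a_j = C(d-2, j) + ½(k+1) C(d-1, j-1)   (k odd, so ½(k+1) = (k+1)/2 ∈ ℕ)
aCoef : (k d j : ℕ) → ℤ
aCoef k d j = binom (d ℕ.∸ 2) j + + ((k ℕ.+ 1) ℕ./ 2) * binomPred (d ℕ.∸ 1) j

bCoef : (k d j : ℕ) → ℤ
bCoef k d j = + ((k ℕ.∸ 1) ℕ./ 2) * binomPred (d ℕ.∸ 1) j - binomPred (d ℕ.∸ 2) j

claimedAt : (k d : ℕ) → G → ℕ → ℤ
claimedAt k d g n = if n ℕ.≤ᵇ d then aCoef k d n * χ₁ g + bCoef k d n * χ₂ g else 0ℤ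

module Submission where

-- Write ehr_d(g) for the Ehrhart series of P(k,d)^g. The slice of m·P(k,d+1) at first
-- coordinate z is (m - |z|)·P(k,d), so ehr_{d+1}(g)_m = Σ_{|z| ≤ m} ehr_d(g)_{m-|z|}, that is
-- (1 - t)·ehr_{d+1}(g) = (1 + t)·ehr_d(g). The new coordinate is fixed by A_g, so the multiplier
-- (1 - t)·det(I - t A_g) gains a factor (1 - t), and therefore H*_{d+1}(g) = (1 + t)·H*_d(g)
-- for d ≥ 1. The claimed coefficients obey the same Pascal recurrence in d, which leaves d = 2,
-- where H*_2 = (1 + t)·H*_1 is computed from the one-dimensional counts: 1 + 2⌊km/2⌋ points
-- for g = 1 and the single point 0 for g = σ. Oddness of k enters only here, through
-- (k + 1)/2 + (k - 1)/2 = k, (k + 1)/2 - (k - 1)/2 = 1 and 1 + 2⌊k/2⌋ = k.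

open import Defs
open import Data.Bool using (if_then_else_; true; false)
open import Data.Integer as ℤ using (ℤ; ∣_∣; _⊖_)
import Data.Integer.Properties as ℤ
open import Data.List as List using (List; []; _∷_; applyUpTo; length; filter; concatMap)
open import Data.List.Properties
  using (applyUpTo-∷ʳ; map-applyUpTo; map-cong; length-++; filter-++; filter-≐; filter-none)
import Data.List.Relation.Unary.All as All
open import Data.Nat as ℕ using (ℕ; zero; suc; _∸_; _≤_; _<_; _≤ᵇ_; _%_; z≤n; s≤s; ⌊_/2⌋; NonZero)
open import Data.Nat.Combinatorics using (_C_; k>n⇒nCk≡0; nCk+nC[k+1]≡[n+1]C[k+1])
import Data.Nat.DivMod as ℕ
open import Data.Nat.ListAction using (sum)
open import Data.Nat.ListAction.Properties using (sum-++)
import Data.Nat.Properties as ℕ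
import Data.Nat.Tactic.RingSolver as ℕ-Solver
open import Data.Product using (_×_; _,_; proj₁; proj₂)
open import Data.Unit using (⊤; tt)
open import Data.Vec using (Vec; []; _∷_)
open import Data.Vec.Properties using (≡-dec; ∷-injectiveʳ)
open import Function using (_∘_; id)
open import Function.Bundles using (_⇔_; mk⇔; Equivalence)
open import Relation.Nullary.Decidable using (does; yes; _×-dec_)
open import Relation.Nullary.Reflects using (ofʸ; ofⁿ)
open import Relation.Unary using (Pred; Decidable)
open import Relation.Binary.PropositionalEquality
import Relation.Binary.Reasoning.Setoid as SetoidReasoning

module LatticeCounting where

  open import Data.Nat using (_+_; _*_)
  open import Data.Nat.Tactic.RingSolver using (solve-∀)

  sumUpTo : (ℕ → ℕ) → ℕ → ℕ
  sumUpTo f n = sum (applyUpTo f n)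

  syntax sumUpTo (λ i → e) n = ∑[ i < n ] e

  ∑-cong : ∀ {f g} n → (∀ i → f i ≡ g i) → sumUpTo f n ≡ sumUpTo g n
  ∑-cong zero    f≗g = refl
  ∑-cong (suc n) f≗g = cong₂ _+_ (f≗g 0) (∑-cong n (f≗g ∘ suc))

  ∑-suc : ∀ f n → ∑[ i < suc n ] f i ≡ ∑[ i < n ] f i + f n
  ∑-suc f n = begin
    sum (applyUpTo f (suc n))          ≡⟨ cong sum (applyUpTo-∷ʳ f n) ⟨
    sum (applyUpTo f n List.∷ʳ f n)    ≡⟨ sum-++ (applyUpTo f n) (f n ∷ []) ⟩
    sum (applyUpTo f n) + (f n + 0)    ≡⟨ cong (sum (applyUpTo f n) +_) (ℕ.+-identityʳ (f n)) ⟩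
    sum (applyUpTo f n) + f n          ∎
    where open ≡-Reasoning

  ∑-const : ∀ c n → ∑[ i < n ] c ≡ n * c
  ∑-const c zero    = refl
  ∑-const c (suc n) = cong (c +_) (∑-const c n)

  -- The left-hand side is Σ_{z = -B}^{B} h ∣z∣, with z = i - B.
  ∑-distance : ∀ h B → ∑[ i < suc (B + B) ] h ∣ i ⊖ B ∣ ≡ h 0 + 2 * ∑[ i < B ] h (suc i)
  ∑-distance h zero    = refl
  ∑-distance h (suc B) = begin
    h (suc B) + ∑[ i < suc B + suc B ] h ∣ suc i ⊖ suc B ∣
      ≡⟨ cong (h (suc B) +_) (∑-cong (suc B + suc B) λ i → cong (h ∘ ∣_∣) (ℤ.[1+m]⊖[1+n]≡m⊖n i B)) ⟩
    h (suc B) + ∑[ i < suc B + suc B ] h ∣ i ⊖ B ∣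
      ≡⟨ cong (λ n → h (suc B) + ∑[ i < suc n ] h ∣ i ⊖ B ∣) (ℕ.+-suc B B) ⟩
    h (suc B) + ∑[ i < suc (suc (B + B)) ] h ∣ i ⊖ B ∣
      ≡⟨ cong (h (suc B) +_) (∑-suc (λ i → h ∣ i ⊖ B ∣) (suc (B + B))) ⟩
    h (suc B) + (∑[ i < suc (B + B) ] h ∣ i ⊖ B ∣ + h ∣ suc B + B ⊖ B ∣)
      ≡⟨ cong₂ (λ s t → h (suc B) + (s + h t)) (∑-distance h B) top ⟩
    h (suc B) + ((h 0 + 2 * ∑[ i < B ] h (suc i)) + h (suc B))
      ≡⟨ regroup (h 0) (∑[ i < B ] h (suc i)) (h (suc B)) ⟩
    h 0 + 2 * (∑[ i < B ] h (suc i) + h (suc B))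
      ≡⟨ cong (λ s → h 0 + 2 * s) (∑-suc (h ∘ suc) B) ⟨
    h 0 + 2 * ∑[ i < suc B ] h (suc i) ∎
    where
    open ≡-Reasoning
    top : ∣ suc B + B ⊖ B ∣ ≡ suc B
    top = cong ∣_∣ (trans (ℤ.⊖-≥ (ℕ.m≤n+m B (suc B))) (cong ℤ.+_ (ℕ.m+n∸n≡m (suc B) B)))
    regroup : ∀ a s c → c + ((a + 2 * s) + c) ≡ a + 2 * (s + c)
    regroup = solve-∀

  ∑-range : ∀ h B → sum (List.map (h ∘ ∣_∣) (range B)) ≡ h 0 + 2 * ∑[ i < B ] h (suc i)
  ∑-range h B = begin
    sum (List.map (h ∘ ∣_∣) (List.map z (applyUpTo id (suc (B + B)))))
      ≡⟨ cong (sum ∘ List.map (h ∘ ∣_∣)) (map-applyUpTo id z (suc (B + B))) ⟩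
    sum (List.map (h ∘ ∣_∣) (applyUpTo z (suc (B + B))))
      ≡⟨ cong sum (map-applyUpTo z (h ∘ ∣_∣) (suc (B + B))) ⟩
    ∑[ i < suc (B + B) ] h ∣ z i ∣
      ≡⟨ ∑-cong (suc (B + B)) (λ i → cong (h ∘ ∣_∣) (ℤ.[+m]-[+n]≡m⊖n i B)) ⟩
    ∑[ i < suc (B + B) ] h ∣ i ⊖ B ∣
      ≡⟨ ∑-distance h B ⟩
    h 0 + 2 * ∑[ i < B ] h (suc i) ∎
    where
    open ≡-Reasoning
    z : ℕ → ℤ
    z i = ℤ.+ i ℤ.- ℤ.+ B

  module _ {a p} {A : Set a} {P : Pred A p} (P? : Decidable P) where

    length-filter-concatMap : ∀ {b} {B : Set b} (f : B → List A) xs →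
      length (filter P? (concatMap f xs)) ≡ sum (List.map (length ∘ filter P? ∘ f) xs)
    length-filter-concatMap f []       = refl
    length-filter-concatMap f (x ∷ xs) = begin
      length (filter P? (f x List.++ concatMap f xs))
        ≡⟨ cong length (filter-++ P? (f x) (concatMap f xs)) ⟩
      length (filter P? (f x) List.++ filter P? (concatMap f xs))
        ≡⟨ length-++ (filter P? (f x)) ⟩
      length (filter P? (f x)) + length (filter P? (concatMap f xs))
        ≡⟨ cong (length (filter P? (f x)) +_) (length-filter-concatMap f xs) ⟩
      length (filter P? (f x)) + sum (List.map (length ∘ filter P? ∘ f) xs) ∎
      where open ≡-Reasoning

    length-filter-map : ∀ {b} {B : Set b} (f : B → A) xs →
      length (filter P? (List.map f xs)) ≡ length (filter (P? ∘ f) xs)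
    length-filter-map f []       = refl
    length-filter-map f (x ∷ xs) with does (P? (f x))
    ... | true  = cong suc (length-filter-map f xs)
    ... | false = length-filter-map f xs

  trunc : (ℕ → ℕ) → ℕ → ℕ → ℕ
  trunc φ m i = if i ≤ᵇ m then φ (m ∸ i) else 0

  trunc-cong : ∀ {φ ψ} m i → (∀ j → j ≤ m → φ j ≡ ψ j) → trunc φ m i ≡ trunc ψ m i
  trunc-cong m i φ≗ψ with i ≤ᵇ m | ℕ.≤ᵇ-reflects-≤ i m
  ... | true  | ofʸ _ = φ≗ψ (m ∸ i) (ℕ.m∸n≤m m i)
  ... | false | ofⁿ _ = refl

  ∑-trunc : ∀ φ m B → m ≤ B → ∑[ i < B ] trunc φ m (suc i) ≡ ∑[ i < m ] φ (m ∸ suc i)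
  ∑-trunc φ zero    B       _         = trans (∑-const 0 B) (ℕ.*-zeroʳ B)
  ∑-trunc φ (suc m) (suc B) (s≤s m≤B) = cong (φ m +_) (∑-trunc φ m B m≤B)

  module _ {a b p q} {A : Set a} {B : Set b} {P : Pred A p} (P? : Decidable P)
           {Q : ℕ → Pred B q} (Q? : ∀ j → Decidable (Q j)) where

    length-filter-slice : ∀ (f : B → A) a m xs → (∀ x → P (f x) ⇔ (a ≤ m × Q (m ∸ a) x)) →
      length (filter P? (List.map f xs)) ≡ trunc (λ j → length (filter (Q? j) xs)) m a
    length-filter-slice f a m xs P⇔ with a ≤ᵇ m | ℕ.≤ᵇ-reflects-≤ a m
    ... | true  | ofʸ a≤m = trans (length-filter-map P? f xs)
      (cong length (filter-≐ (P? ∘ f) (Q? (m ∸ a))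
        ((λ {x} → proj₂ ∘ Equivalence.to (P⇔ x)) , (λ {x} q → Equivalence.from (P⇔ x) (a≤m , q))) xs))
    ... | false | ofⁿ a≰m = trans (length-filter-map P? f xs)
      (cong length (filter-none (P? ∘ f) (All.universal (λ x → a≰m ∘ proj₁ ∘ Equivalence.to (P⇔ x)) xs)))

  count-slices : ∀ {p d} {P : Pred (Vec ℤ (suc d)) p} (P? : Decidable P) xs φ m B → m ≤ B →
    (∀ z → length (filter P? (List.map (z ∷_) xs)) ≡ trunc φ m ∣ z ∣) →
    length (filter P? (concatMap (λ z → List.map (z ∷_) xs) (range B)))
      ≡ φ m + 2 * ∑[ i < m ] φ (m ∸ suc i)
  count-slices P? xs φ m B m≤B slice = begin
    length (filter P? (concatMap (λ z → List.map (z ∷_) xs) (range B)))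
      ≡⟨ length-filter-concatMap P? (λ z → List.map (z ∷_) xs) (range B) ⟩
    sum (List.map (λ z → length (filter P? (List.map (z ∷_) xs))) (range B))
      ≡⟨ cong sum (map-cong slice (range B)) ⟩
    sum (List.map (trunc φ m ∘ ∣_∣) (range B))
      ≡⟨ ∑-range (trunc φ m) B ⟩
    φ m + 2 * ∑[ i < B ] trunc φ m (suc i)
      ≡⟨ cong (λ s → φ m + 2 * s) (∑-trunc φ m B m≤B) ⟩
    φ m + 2 * ∑[ i < m ] φ (m ∸ suc i) ∎
    where open ≡-Reasoning

  m*2≤n⇒m≤⌊n/2⌋ : ∀ m n → m * 2 ≤ n → m ≤ ⌊ n /2⌋
  m*2≤n⇒m≤⌊n/2⌋ zero    n             _                 = z≤n
  m*2≤n⇒m≤⌊n/2⌋ (suc m) (suc (suc n)) (s≤s (s≤s m*2≤n)) = s≤s (m*2≤n⇒m≤⌊n/2⌋ m n m*2≤n)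

  m≤⌊n/2⌋⇒m*2≤n : ∀ m n → m ≤ ⌊ n /2⌋ → m * 2 ≤ n
  m≤⌊n/2⌋⇒m*2≤n zero    n             _         = z≤n
  m≤⌊n/2⌋⇒m*2≤n (suc m) (suc (suc n)) (s≤s m≤n) = s≤s (s≤s (m≤⌊n/2⌋⇒m*2≤n m n m≤n))

  ⌊m*2+n/2⌋≡m+⌊n/2⌋ : ∀ m n → ⌊ m * 2 + n /2⌋ ≡ m + ⌊ n /2⌋
  ⌊m*2+n/2⌋≡m+⌊n/2⌋ zero    n = refl
  ⌊m*2+n/2⌋≡m+⌊n/2⌋ (suc m) n = cong suc (⌊m*2+n/2⌋≡m+⌊n/2⌋ m n)

  inDilateFix? : ∀ k d m g → Decidable (inDilateFix k d m g)
  inDilateFix? k d m g x = inDilate? k d m x ×-dec ≡-dec ℤ._≟_ (act g x) x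

  count : (k d : ℕ) → G → (B m : ℕ) → ℕ
  count k d g B m = length (filter (inDilateFix? k d m g) (box d B))

  act-∷ : ∀ {d} g z (x : Vec ℤ (suc d)) → act g (z ∷ x) ≡ z ∷ act g x
  act-∷ one z x = cong (_∷ _) (ℤ.*-identityˡ z)
  act-∷ σ   z x = cong (_∷ _) (ℤ.*-identityˡ z)

  k*a+n≤k*m⇔a≤m×n≤k*[m∸a] : ∀ k .{{_ : NonZero k}} a n m →
    k * a + n ≤ k * m ⇔ (a ≤ m × n ≤ k * (m ∸ a))
  k*a+n≤k*m⇔a≤m×n≤k*[m∸a] k a n m = mk⇔
    (λ le → let a≤m = ℕ.*-cancelˡ-≤ k (ℕ.≤-trans (ℕ.m≤m+n (k * a) n) le) in
      a≤m , ℕ.+-cancelˡ-≤ (k * a) n (k * (m ∸ a)) (subst (k * a + n ≤_) (sym (split a≤m)) le))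
    (λ (a≤m , n≤) → subst (k * a + n ≤_) (split a≤m) (ℕ.+-monoʳ-≤ (k * a) n≤))
    where
    split : a ≤ m → k * a + k * (m ∸ a) ≡ k * m
    split a≤m = trans (sym (ℕ.*-distribˡ-+ k a (m ∸ a))) (cong (k *_) (ℕ.m+[n∸m]≡n a≤m))

  inDilateFix-∷ : ∀ k .{{_ : NonZero k}} d m g z (x : Vec ℤ (suc d)) →
    inDilateFix k (2 + d) m g (z ∷ x) ⇔ (∣ z ∣ ≤ m × inDilateFix k (suc d) (m ∸ ∣ z ∣) g x)
  inDilateFix-∷ k d m g z x = mk⇔
    (λ (le , fixed) → let a≤m , n≤ = Equivalence.to weights le in
      a≤m , n≤ , ∷-injectiveʳ (trans (sym (act-∷ g z x)) fixed))
    (λ (a≤m , n≤ , fixed) →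
      Equivalence.from weights (a≤m , n≤) , trans (act-∷ g z x) (cong (z ∷_) fixed))
    where weights = k*a+n≤k*m⇔a≤m×n≤k*[m∸a] k ∣ z ∣ (wnorm k x) m

  inDilateFix-[z]-one : ∀ k m z → inDilateFix k 1 m one (z ∷ []) ⇔ (∣ z ∣ ≤ ⌊ k * m /2⌋ × ⊤)
  inDilateFix-[z]-one k m z = mk⇔
    (λ (le , _) → m*2≤n⇒m≤⌊n/2⌋ ∣ z ∣ (k * m) (subst (_≤ k * m) double le) , tt)
    (λ (le , _) → subst (_≤ k * m) (sym double) (m≤⌊n/2⌋⇒m*2≤n ∣ z ∣ (k * m) le)
                , cong (_∷ []) (ℤ.*-identityˡ z))
    where
    double : 2 * ∣ z ∣ + 0 ≡ ∣ z ∣ * 2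
    double = trans (ℕ.+-identityʳ _) (ℕ.*-comm 2 ∣ z ∣)

  inDilateFix-[z]-σ : ∀ k m z → inDilateFix k 1 m σ (z ∷ []) ⇔ (∣ z ∣ ≤ 0 × ⊤)
  inDilateFix-[z]-σ k m z = mk⇔ (to z) (from z)
    where
    to : ∀ z → inDilateFix k 1 m σ (z ∷ []) → ∣ z ∣ ≤ 0 × ⊤
    to (ℤ.+ zero)  _        = z≤n , tt
    to (ℤ.+ suc n) (_ , ())
    to ℤ.-[1+ n ]  (_ , ())
    from : ∀ z → ∣ z ∣ ≤ 0 × ⊤ → inDilateFix k 1 m σ (z ∷ [])
    from (ℤ.+ zero) _ = z≤n , refl

  -- points k e g m = |m·P(k,1+e)^g ∩ ℤ^(1+e)|, counted slice by slice along the first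
  -- coordinate; in dimension 1 it counts |z| ≤ km/2 (g = 1), respectively z = 0 (g = σ).
  points : (k e : ℕ) → G → ℕ → ℕ
  points k zero    one m = suc (2 * ⌊ k * m /2⌋)
  points k zero    σ   m = 1
  points k (suc e) g   m = points k e g m + 2 * ∑[ i < m ] points k e g (m ∸ suc i)

  module _ (k : ℕ) .{{_ : NonZero k}} where

    count-points : ∀ e g B m → k * m ≤ B → count k (suc e) g B m ≡ points k e g m
    count-points zero one B m km≤B = trans
      (count-slices (inDilateFix? k 1 m one) ([] ∷ []) (λ _ → 1) ⌊ k * m /2⌋ B
        (ℕ.≤-trans (ℕ.⌊n/2⌋≤n (k * m)) km≤B)
        (λ z → length-filter-slice (inDilateFix? k 1 m one) {Q = λ _ _ → ⊤} (λ _ _ → yes tt)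
                 (z ∷_) ∣ z ∣ ⌊ k * m /2⌋ ([] ∷ []) (λ { [] → inDilateFix-[z]-one k m z })))
      (cong (λ s → suc (2 * s)) (trans (∑-const 1 ⌊ k * m /2⌋) (ℕ.*-identityʳ ⌊ k * m /2⌋)))
    count-points zero σ B m _ =
      count-slices (inDilateFix? k 1 m σ) ([] ∷ []) (λ _ → 1) 0 B z≤n
        (λ z → length-filter-slice (inDilateFix? k 1 m σ) {Q = λ _ _ → ⊤} (λ _ _ → yes tt)
                 (z ∷_) ∣ z ∣ 0 ([] ∷ []) (λ { [] → inDilateFix-[z]-σ k m z }))
    count-points (suc e) g B m km≤B =
      count-slices (inDilateFix? k (2 + e) m g) (box (suc e) B) (points k e g) m B
        (ℕ.≤-trans (ℕ.m≤n*m m k) km≤B)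
        (λ z → trans
          (length-filter-slice (inDilateFix? k (2 + e) m g) (λ j → inDilateFix? k (suc e) j g)
             (z ∷_) ∣ z ∣ m (box (suc e) B) (inDilateFix-∷ k e m g z))
          (trunc-cong m ∣ z ∣ λ j j≤m → count-points e g B j (ℕ.≤-trans (ℕ.*-monoʳ-≤ k j≤m) km≤B)))

    latticeCount-points : ∀ e g m → latticeCount k (suc e) g m ≡ points k e g m
    latticeCount-points e g m = count-points e g (k * m) m ℕ.≤-refl

  points-suc : ∀ k e g m →
    points k (suc e) g (suc m) ≡ points k (suc e) g m + (points k e g (suc m) + points k e g m)
  points-suc k e g m =
    regroup (points k e g (suc m)) (points k e g m) (∑[ i < m ] points k e g (m ∸ suc i))
    where
    regroup : ∀ a b s → a + 2 * (b + s) ≡ (b + 2 * s) + (a + b)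
    regroup = solve-∀

open LatticeCounting
open import Data.Integer using (+_; -_; 0ℤ; 1ℤ; _+_; _-_; _*_)
open import Data.Integer.Tactic.RingSolver using (solve-∀)

module ≗-Reasoning = SetoidReasoning (ℕ →-setoid ℤ)

-- Power series are coefficient sequences: shift f = t·f, p ⊙ f = p(t)·f, Δ f = (1 - t)·f and
-- Δ⁺ f = (1 + t)·f.
Series : Set
Series = ℕ → ℤ

shift : Series → Series
shift f zero    = 0ℤ
shift f (suc n) = f n

infixr 7 _⊙_

_⊙_ : Poly → Series → Series
([]      ⊙ f) n = 0ℤ
((a ∷ p) ⊙ f) n = a * f n + shift (p ⊙ f) n

Δ Δ⁺ : Series → Series
Δ  f n = f n - shift f n
Δ⁺ f n = f n + shift f n

shift-cong : ∀ {f g} → f ≗ g → shift f ≗ shift g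
shift-cong f≗g zero    = refl
shift-cong f≗g (suc n) = f≗g n

⊙-cong : ∀ p {f g} → f ≗ g → p ⊙ f ≗ p ⊙ g
⊙-cong []      f≗g n = refl
⊙-cong (a ∷ p) f≗g n = cong₂ (λ x y → a * x + y) (f≗g n) (shift-cong (⊙-cong p f≗g) n)

Δ-cong : ∀ {f g} → f ≗ g → Δ f ≗ Δ g
Δ-cong f≗g n = cong₂ _-_ (f≗g n) (shift-cong f≗g n)

Δ⁺-cong : ∀ {f g} → f ≗ g → Δ⁺ f ≗ Δ⁺ g
Δ⁺-cong f≗g n = cong₂ _+_ (f≗g n) (shift-cong f≗g n)

shift-0 : shift (λ _ → 0ℤ) ≗ λ _ → 0ℤ
shift-0 zero    = refl
shift-0 (suc n) = refl

shift-+ : ∀ f g → shift (λ n → f n + g n) ≗ λ n → shift f n + shift g n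
shift-+ f g zero    = refl
shift-+ f g (suc n) = refl

shift-* : ∀ a f → shift (λ n → a * f n) ≗ λ n → a * shift f n
shift-* a f zero    = sym (ℤ.*-zeroʳ a)
shift-* a f (suc n) = refl

a*0+0≡0 : ∀ a → a * 0ℤ + 0ℤ ≡ 0ℤ
a*0+0≡0 a = trans (ℤ.+-identityʳ (a * 0ℤ)) (ℤ.*-zeroʳ a)

⊙-zeroʳ : ∀ p → p ⊙ (λ _ → 0ℤ) ≗ λ _ → 0ℤ
⊙-zeroʳ []      n = refl
⊙-zeroʳ (a ∷ p) n =
  trans (cong (_+_ (a * 0ℤ)) (trans (shift-cong (⊙-zeroʳ p) n) (shift-0 n))) (a*0+0≡0 a)

⊙-shift : ∀ p f → p ⊙ shift f ≗ shift (p ⊙ f)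
⊙-shift []      f n       = sym (shift-0 n)
⊙-shift (a ∷ p) f zero    = a*0+0≡0 a
⊙-shift (a ∷ p) f (suc n) = cong (_+_ (a * f n)) (⊙-shift p f n)

⊙-linear : ∀ p a f g → p ⊙ (λ n → a * f n + g n) ≗ λ n → a * (p ⊙ f) n + (p ⊙ g) n
⊙-linear []      a f g n = sym (a*0+0≡0 a)
⊙-linear (b ∷ p) a f g n = begin
  b * (a * f n + g n) + shift (p ⊙ (λ m → a * f m + g m)) n
    ≡⟨ cong (_+_ (b * (a * f n + g n))) (trans (shift-cong (⊙-linear p a f g) n)
         (trans (shift-+ (λ m → a * (p ⊙ f) m) (p ⊙ g) n)
                (cong (_+ shift (p ⊙ g) n) (shift-* a (p ⊙ f) n)))) ⟩
  b * (a * f n + g n) + (a * shift (p ⊙ f) n + shift (p ⊙ g) n)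
    ≡⟨ regroup a b (f n) (g n) (shift (p ⊙ f) n) (shift (p ⊙ g) n) ⟩
  a * (b * f n + shift (p ⊙ f) n) + (b * g n + shift (p ⊙ g) n) ∎
  where
  open ≡-Reasoning
  regroup : ∀ a b x y u v → b * (a * x + y) + (a * u + v) ≡ a * (b * x + u) + (b * y + v)
  regroup = solve-∀

⊙-comm : ∀ p q f → p ⊙ q ⊙ f ≗ q ⊙ p ⊙ f
⊙-comm p []      f   = ⊙-zeroʳ p
⊙-comm p (b ∷ q) f n = trans (⊙-linear p b f (shift (q ⊙ f)) n)
  (cong (_+_ (b * (p ⊙ f) n)) (trans (⊙-shift p (q ⊙ f) n) (shift-cong (⊙-comm p q f) n)))

⊙-polyAdd : ∀ p q f → polyAdd p q ⊙ f ≗ λ n → (p ⊙ f) n + (q ⊙ f) n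
⊙-polyAdd []      q       f n = sym (ℤ.+-identityˡ _)
⊙-polyAdd (a ∷ p) []      f n = sym (ℤ.+-identityʳ _)
⊙-polyAdd (a ∷ p) (b ∷ q) f n = begin
  (a + b) * f n + shift (polyAdd p q ⊙ f) n
    ≡⟨ cong (_+_ ((a + b) * f n)) (trans (shift-cong (⊙-polyAdd p q f) n) (shift-+ (p ⊙ f) (q ⊙ f) n)) ⟩
  (a + b) * f n + (shift (p ⊙ f) n + shift (q ⊙ f) n)
    ≡⟨ regroup a b (f n) (shift (p ⊙ f) n) (shift (q ⊙ f) n) ⟩
  (a * f n + shift (p ⊙ f) n) + (b * f n + shift (q ⊙ f) n) ∎
  where
  open ≡-Reasoning
  regroup : ∀ a b x u v → (a + b) * x + (u + v) ≡ (a * x + u) + (b * x + v)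
  regroup = solve-∀

⊙-scale : ∀ a q f → List.map (a *_) q ⊙ f ≗ λ n → a * (q ⊙ f) n
⊙-scale a []      f n = sym (ℤ.*-zeroʳ a)
⊙-scale a (b ∷ q) f n = begin
  a * b * f n + shift (List.map (a *_) q ⊙ f) n
    ≡⟨ cong (_+_ (a * b * f n)) (trans (shift-cong (⊙-scale a q f) n) (shift-* a (q ⊙ f) n)) ⟩
  a * b * f n + a * shift (q ⊙ f) n
    ≡⟨ regroup a b (f n) (shift (q ⊙ f) n) ⟩
  a * (b * f n + shift (q ⊙ f) n) ∎
  where
  open ≡-Reasoning
  regroup : ∀ a b x u → a * b * x + a * u ≡ a * (b * x + u)
  regroup = solve-∀

⊙-polyMul : ∀ p q f → polyMul p q ⊙ f ≗ p ⊙ q ⊙ f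
⊙-polyMul []      q f n = refl
⊙-polyMul (a ∷ p) q f n = begin
  (polyAdd (List.map (a *_) q) (0ℤ ∷ polyMul p q) ⊙ f) n
    ≡⟨ ⊙-polyAdd (List.map (a *_) q) (0ℤ ∷ polyMul p q) f n ⟩
  (List.map (a *_) q ⊙ f) n + (0ℤ * f n + shift (polyMul p q ⊙ f) n)
    ≡⟨ cong₂ _+_ (⊙-scale a q f n) (trans (ℤ.+-identityˡ _) (shift-cong (⊙-polyMul p q f) n)) ⟩
  a * (q ⊙ f) n + shift (p ⊙ q ⊙ f) n ∎
  where open ≡-Reasoning

⊙-one : ∀ f → (1ℤ ∷ []) ⊙ f ≗ f
⊙-one f n = trans (cong (_+_ (1ℤ * f n)) (shift-0 n)) (trans (ℤ.+-identityʳ _) (ℤ.*-identityˡ (f n)))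

⊙-polyMul₂ : ∀ p q f → polyMul p (polyMul q (1ℤ ∷ [])) ⊙ f ≗ p ⊙ q ⊙ f
⊙-polyMul₂ p q f = begin
  polyMul p (polyMul q (1ℤ ∷ [])) ⊙ f  ≈⟨ ⊙-polyMul p (polyMul q (1ℤ ∷ [])) f ⟩
  p ⊙ polyMul q (1ℤ ∷ []) ⊙ f          ≈⟨ ⊙-cong p (⊙-polyMul q (1ℤ ∷ []) f) ⟩
  p ⊙ q ⊙ (1ℤ ∷ []) ⊙ f                ≈⟨ ⊙-cong p (⊙-cong q (⊙-one f)) ⟩
  p ⊙ q ⊙ f                            ∎
  where open ≗-Reasoning

⊙-degree-one : ∀ a b f → (a ∷ b ∷ []) ⊙ f ≗ λ n → a * f n + b * shift f n
⊙-degree-one a b f zero    = cong (_+_ (a * f zero)) (sym (ℤ.*-zeroʳ b))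
⊙-degree-one a b f (suc n) =
  cong (_+_ (a * f (suc n))) (trans (cong (_+_ (b * f n)) (shift-0 n)) (ℤ.+-identityʳ _))

Δ-⊙ : ∀ f → (1ℤ ∷ - 1ℤ ∷ []) ⊙ f ≗ Δ f
Δ-⊙ f n = trans (⊙-degree-one 1ℤ (- 1ℤ) f n) (unit-coefficients (f n) (shift f n))
  where
  unit-coefficients : ∀ x y → 1ℤ * x + - 1ℤ * y ≡ x - y
  unit-coefficients = solve-∀

Δ⁺-⊙ : ∀ f → (1ℤ ∷ 1ℤ ∷ []) ⊙ f ≗ Δ⁺ f
Δ⁺-⊙ f n = trans (⊙-degree-one 1ℤ 1ℤ f n) (cong₂ _+_ (ℤ.*-identityˡ (f n)) (ℤ.*-identityˡ (shift f n)))

convolution≡⊙ : ∀ p f n → List.foldr _+_ 0ℤ (applyUpTo (λ i → coeff p i * f (n ∸ i)) (suc n)) ≡ (p ⊙ f) n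
convolution≡⊙ []      f zero    = refl
convolution≡⊙ []      f (suc n) = cong (_+_ 0ℤ) (convolution≡⊙ [] f n)
convolution≡⊙ (a ∷ p) f zero    = refl
convolution≡⊙ (a ∷ p) f (suc n) = cong (_+_ (a * f (suc n))) (convolution≡⊙ p f n)

polyTimesSeries-⊙ : ∀ p f → polyTimesSeries p f ≗ p ⊙ f
polyTimesSeries-⊙ p f n = trans
  (cong (List.foldr _+_ 0ℤ) (map-applyUpTo id (λ i → coeff p i * f (n ∸ i)) (suc n)))
  (convolution≡⊙ p f n)

polyMul-Δ : ∀ M {f f′} → Δ f ≗ Δ⁺ f′ → polyMul (1ℤ ∷ - 1ℤ ∷ []) M ⊙ f ≗ Δ⁺ (M ⊙ f′)
polyMul-Δ M {f} {f′} Δf≗Δ⁺f′ = begin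
  polyMul (1ℤ ∷ - 1ℤ ∷ []) M ⊙ f  ≈⟨ ⊙-polyMul (1ℤ ∷ - 1ℤ ∷ []) M f ⟩
  (1ℤ ∷ - 1ℤ ∷ []) ⊙ M ⊙ f        ≈⟨ ⊙-comm (1ℤ ∷ - 1ℤ ∷ []) M f ⟩
  M ⊙ (1ℤ ∷ - 1ℤ ∷ []) ⊙ f        ≈⟨ ⊙-cong M (Δ-⊙ f) ⟩
  M ⊙ Δ f                         ≈⟨ ⊙-cong M Δf≗Δ⁺f′ ⟩
  M ⊙ Δ⁺ f′                       ≈⟨ ⊙-cong M (Δ⁺-⊙ f′) ⟨
  M ⊙ (1ℤ ∷ 1ℤ ∷ []) ⊙ f′         ≈⟨ ⊙-comm M (1ℤ ∷ 1ℤ ∷ []) f′ ⟩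
  (1ℤ ∷ 1ℤ ∷ []) ⊙ M ⊙ f′         ≈⟨ Δ⁺-⊙ (M ⊙ f′) ⟩
  Δ⁺ (M ⊙ f′)                     ∎
  where open ≗-Reasoning

Δ⁺ΔΔ-quasiLinear : ∀ {F K} → F 0 ≡ 1ℤ → F 1 ≡ K → (∀ m → F (2 ℕ.+ m) ≡ F m + (K + K)) →
  Δ⁺ (Δ (Δ F)) ≗ coeff (1ℤ ∷ K - 1ℤ ∷ K ∷ [])
Δ⁺ΔΔ-quasiLinear F0 F1 F2+ zero rewrite F0 = refl
Δ⁺ΔΔ-quasiLinear {K = K} F0 F1 F2+ 1 rewrite F0 | F1 = linear K
  where
  linear : ∀ K → ((K - 1ℤ) - (1ℤ - 0ℤ)) + ((1ℤ - 0ℤ) - 0ℤ) ≡ K - 1ℤ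
  linear = solve-∀
Δ⁺ΔΔ-quasiLinear {K = K} F0 F1 F2+ 2 rewrite F2+ 0 | F0 | F1 = quadratic K
  where
  quadratic : ∀ K → (((1ℤ + (K + K)) - K) - (K - 1ℤ)) + ((K - 1ℤ) - (1ℤ - 0ℤ)) ≡ K
  quadratic = solve-∀
Δ⁺ΔΔ-quasiLinear {F} {K} F0 F1 F2+ (suc (suc (suc m))) rewrite F2+ (suc m) | F2+ m =
  higher K (F m) (F (suc m))
  where
  higher : ∀ K x y →
    (((y + (K + K)) - (x + (K + K))) - ((x + (K + K)) - y)) + (((x + (K + K)) - y) - (y - x)) ≡ 0ℤ
  higher = solve-∀

Δ⁺ΔΔ⁺-const : ∀ {F} → F ≗ (λ _ → 1ℤ) → Δ⁺ (Δ (Δ⁺ F)) ≗ coeff (1ℤ ∷ + 2 ∷ 1ℤ ∷ [])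
Δ⁺ΔΔ⁺-const F≗1 n = trans (Δ⁺-cong (Δ-cong (Δ⁺-cong F≗1)) n) (values n)
  where
  values : Δ⁺ (Δ (Δ⁺ (λ _ → 1ℤ))) ≗ coeff (1ℤ ∷ + 2 ∷ 1ℤ ∷ [])
  values zero                = refl
  values 1                   = refl
  values 2                   = refl
  values (suc (suc (suc m))) = refl

ehr : (k d : ℕ) → G → Series
ehr k d g m = + latticeCount k d g m

[+m+n]-[+m]≡+n : ∀ m n → + (m ℕ.+ n) - + m ≡ + n
[+m+n]-[+m]≡+n m n =
  trans (ℤ.[+m]-[+n]≡m⊖n (m ℕ.+ n) m) (trans (ℤ.⊖-≥ (ℕ.m≤m+n m n)) (cong +_ (ℕ.m+n∸m≡n m n)))

Δ-points : ∀ k e g → Δ (+_ ∘ points k (suc e) g) ≗ Δ⁺ (+_ ∘ points k e g)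
Δ-points k e g zero    = cong +_ (ℕ.+-identityʳ _)
Δ-points k e g (suc m) = begin
  + points k (suc e) g (suc m) - + points k (suc e) g m
    ≡⟨ cong (λ x → + x - + points k (suc e) g m) (points-suc k e g m) ⟩
  + (points k (suc e) g m ℕ.+ (points k e g (suc m) ℕ.+ points k e g m)) - + points k (suc e) g m
    ≡⟨ [+m+n]-[+m]≡+n (points k (suc e) g m) (points k e g (suc m) ℕ.+ points k e g m) ⟩
  + (points k e g (suc m) ℕ.+ points k e g m)
    ≡⟨ ℤ.pos-+ (points k e g (suc m)) (points k e g m) ⟩
  + points k e g (suc m) + + points k e g m ∎
  where open ≡-Reasoning

module _ (k : ℕ) .{{_ : NonZero k}} where

  Δ-ehr : ∀ e g → Δ (ehr k (2 ℕ.+ e) g) ≗ Δ⁺ (ehr k (suc e) g)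
  Δ-ehr e g = begin
    Δ (ehr k (2 ℕ.+ e) g)         ≈⟨ Δ-cong (cong +_ ∘ latticeCount-points k (suc e) g) ⟩
    Δ (+_ ∘ points k (suc e) g)   ≈⟨ Δ-points k e g ⟩
    Δ⁺ (+_ ∘ points k e g)        ≈⟨ Δ⁺-cong (cong +_ ∘ latticeCount-points k e g) ⟨
    Δ⁺ (ehr k (suc e) g)          ∎
    where open ≗-Reasoning

  ehr-1-σ : ehr k 1 σ ≗ λ _ → 1ℤ
  ehr-1-σ m = cong +_ (latticeCount-points k 0 σ m)

  ehr-1-one-0 : ehr k 1 one 0 ≡ 1ℤ
  ehr-1-one-0 =
    cong +_ (trans (latticeCount-points k 0 one 0) (cong (λ t → suc (2 ℕ.* ⌊ t /2⌋)) (ℕ.*-zeroʳ k)))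

  ehr-1-one-2+ : ∀ m → ehr k 1 one (2 ℕ.+ m) ≡ ehr k 1 one m + (+ k + + k)
  ehr-1-one-2+ m = begin
    + latticeCount k 1 one (2 ℕ.+ m)
      ≡⟨ cong +_ (latticeCount-points k 0 one (2 ℕ.+ m)) ⟩
    + suc (2 ℕ.* ⌊ k ℕ.* (2 ℕ.+ m) /2⌋)
      ≡⟨ cong (λ t → + suc (2 ℕ.* ⌊ t /2⌋)) (ℕ.*-distribˡ-+ k 2 m) ⟩
    + suc (2 ℕ.* ⌊ k ℕ.* 2 ℕ.+ k ℕ.* m /2⌋)
      ≡⟨ cong (λ t → + suc (2 ℕ.* t)) (⌊m*2+n/2⌋≡m+⌊n/2⌋ k (k ℕ.* m)) ⟩
    + suc (2 ℕ.* (k ℕ.+ ⌊ k ℕ.* m /2⌋))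
      ≡⟨ cong +_ (regroup k ⌊ k ℕ.* m /2⌋) ⟩
    + (suc (2 ℕ.* ⌊ k ℕ.* m /2⌋) ℕ.+ (k ℕ.+ k))
      ≡⟨ ℤ.pos-+ (suc (2 ℕ.* ⌊ k ℕ.* m /2⌋)) (k ℕ.+ k) ⟩
    + suc (2 ℕ.* ⌊ k ℕ.* m /2⌋) + + (k ℕ.+ k)
      ≡⟨ cong₂ _+_ (cong +_ (latticeCount-points k 0 one m)) (ℤ.pos-+ k k) ⟨
    + latticeCount k 1 one m + (+ k + + k) ∎
    where
    open ≡-Reasoning
    regroup : ∀ k x → suc (2 ℕ.* (k ℕ.+ x)) ≡ suc (2 ℕ.* x) ℕ.+ (k ℕ.+ k)
    regroup = ℕ-Solver.solve-∀

c₊ c₋ : ℕ → ℤ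
c₊ k = + ((k ℕ.+ 1) ℕ./ 2)
c₋ k = + ((k ℕ.∸ 1) ℕ./ 2)

claimed : (k d : ℕ) → G → Series
claimed k d g n = aCoef k d n * χ₁ g + bCoef k d n * χ₂ g

claimedAt≡claimed : ∀ k N g n → claimedAt k (2 ℕ.+ N) g n ≡ claimed k (2 ℕ.+ N) g n
claimedAt≡claimed k N g n with n ≤ᵇ 2 ℕ.+ N | ℕ.≤ᵇ-reflects-≤ n (2 ℕ.+ N)
... | true  | _        = refl
... | false | ofⁿ n≰d = sym (vanishes n (ℕ.≰⇒> n≰d))
  where
  vanishes : ∀ n → 2 ℕ.+ N < n → claimed k (2 ℕ.+ N) g n ≡ 0ℤ
  vanishes (suc n) (s≤s 1+N<n) with N<n ← ℕ.<-trans (ℕ.n<1+n N) 1+N<n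
    rewrite k>n⇒nCk≡0 (ℕ.m<n⇒m<1+n N<n) | k>n⇒nCk≡0 1+N<n | k>n⇒nCk≡0 N<n
    = zeros (c₊ k) (c₋ k) (χ₁ g) (χ₂ g)
    where
    zeros : ∀ p q u v → (+ 0 + p * + 0) * u + (q * + 0 - + 0) * v ≡ 0ℤ
    zeros = solve-∀

pascal : ∀ N → Δ⁺ (binom N) ≗ binom (suc N)
pascal N zero    = refl
pascal N (suc n) = trans (sym (ℤ.pos-+ (N C suc n) (N C n)))
  (cong +_ (trans (ℕ.+-comm (N C suc n) (N C n)) (nCk+nC[k+1]≡[n+1]C[k+1] N n)))

pascal-pred : ∀ N → Δ⁺ (binomPred N) ≗ binomPred (suc N)
pascal-pred N zero          = refl
pascal-pred N 1             = refl
pascal-pred N (suc (suc n)) = pascal N (suc n)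

Δ⁺-claimed : ∀ k N g → Δ⁺ (claimed k (2 ℕ.+ N) g) ≗ claimed k (3 ℕ.+ N) g
Δ⁺-claimed k N g zero    = ℤ.+-identityʳ _
Δ⁺-claimed k N g (suc n) = begin
  claimed k (2 ℕ.+ N) g (suc n) + claimed k (2 ℕ.+ N) g n
    ≡⟨ regroup (binom N (suc n)) (binom (suc N) n) (binom N n) (binomPred (suc N) n) (binomPred N n)
               (c₊ k) (c₋ k) (χ₁ g) (χ₂ g) ⟩
  ((binom N (suc n) + binom N n) + c₊ k * (binom (suc N) n + binomPred (suc N) n)) * χ₁ g
    + (c₋ k * (binom (suc N) n + binomPred (suc N) n) - (binom N n + binomPred N n)) * χ₂ g
    ≡⟨ cong₂ (λ x y → (x + c₊ k * y) * χ₁ g + (c₋ k * y - (binom N n + binomPred N n)) * χ₂ g)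
             (pascal N (suc n)) (pascal-pred (suc N) (suc n)) ⟩
  (binom (suc N) (suc n) + c₊ k * binom (2 ℕ.+ N) n) * χ₁ g
    + (c₋ k * binom (2 ℕ.+ N) n - (binom N n + binomPred N n)) * χ₂ g
    ≡⟨ cong (λ x → (binom (suc N) (suc n) + c₊ k * binom (2 ℕ.+ N) n) * χ₁ g
                   + (c₋ k * binom (2 ℕ.+ N) n - x) * χ₂ g) (pascal-pred N (suc n)) ⟩
  claimed k (3 ℕ.+ N) g (suc n) ∎
  where
  open ≡-Reasoning
  regroup : ∀ x y z w t p q u v →
    ((x + p * y) * u + (q * y - z) * v) + ((z + p * w) * u + (q * w - t) * v)
    ≡ ((x + z) + p * (y + w)) * u + (q * (y + w) - (z + t)) * v
  regroup = solve-∀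

κ : ℕ → G → ℤ
κ k g = c₊ k * χ₁ g + c₋ k * χ₂ g

claimed-2 : ∀ k g → claimed k 2 g ≗ coeff (χ₁ g ∷ κ k g - χ₂ g ∷ κ k g ∷ [])
claimed-2 k g zero                = constant (c₊ k) (c₋ k) (χ₁ g) (χ₂ g)
  where
  constant : ∀ p q u v → (1ℤ + p * 0ℤ) * u + (q * 0ℤ - 0ℤ) * v ≡ u
  constant = solve-∀
claimed-2 k g 1                   = linear (c₊ k) (c₋ k) (χ₁ g) (χ₂ g)
  where
  linear : ∀ p q u v → (0ℤ + p * 1ℤ) * u + (q * 1ℤ - 1ℤ) * v ≡ (p * u + q * v) - v
  linear = solve-∀
claimed-2 k g 2                   = quadratic (c₊ k) (c₋ k) (χ₁ g) (χ₂ g)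
  where
  quadratic : ∀ p q u v → (0ℤ + p * 1ℤ) * u + (q * 1ℤ - 0ℤ) * v ≡ p * u + q * v
  quadratic = solve-∀
claimed-2 k g (suc (suc (suc n))) = zeros (c₊ k) (c₋ k) (χ₁ g) (χ₂ g)
  where
  zeros : ∀ p q u v → (0ℤ + p * 0ℤ) * u + (q * 0ℤ - 0ℤ) * v ≡ 0ℤ
  zeros = solve-∀

multiplier-suc : ∀ e g → multiplier (2 ℕ.+ e) g ≡ polyMul (1ℤ ∷ - 1ℤ ∷ []) (multiplier (suc e) g)
multiplier-suc e one = refl
multiplier-suc e σ   = refl

module _ (k : ℕ) .{{_ : NonZero k}} where

  HstarAt-suc : ∀ e g → HstarAt k (2 ℕ.+ e) g ≗ Δ⁺ (HstarAt k (suc e) g)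
  HstarAt-suc e g = begin
    HstarAt k (2 ℕ.+ e) g
      ≈⟨ polyTimesSeries-⊙ (multiplier (2 ℕ.+ e) g) (ehr k (2 ℕ.+ e) g) ⟩
    multiplier (2 ℕ.+ e) g ⊙ ehr k (2 ℕ.+ e) g
      ≡⟨ cong (_⊙ ehr k (2 ℕ.+ e) g) (multiplier-suc e g) ⟩
    polyMul (1ℤ ∷ - 1ℤ ∷ []) (multiplier (suc e) g) ⊙ ehr k (2 ℕ.+ e) g
      ≈⟨ polyMul-Δ (multiplier (suc e) g) (Δ-ehr k e g) ⟩
    Δ⁺ (multiplier (suc e) g ⊙ ehr k (suc e) g)
      ≈⟨ Δ⁺-cong (polyTimesSeries-⊙ (multiplier (suc e) g) (ehr k (suc e) g)) ⟨
    Δ⁺ (HstarAt k (suc e) g) ∎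
    where open ≗-Reasoning

  HstarAt-1-one : HstarAt k 1 one ≗ Δ (Δ (ehr k 1 one))
  HstarAt-1-one = begin
    HstarAt k 1 one
      ≈⟨ polyTimesSeries-⊙ (multiplier 1 one) (ehr k 1 one) ⟩
    multiplier 1 one ⊙ ehr k 1 one
      ≈⟨ ⊙-polyMul₂ (1ℤ ∷ - 1ℤ ∷ []) (1ℤ ∷ - 1ℤ ∷ []) (ehr k 1 one) ⟩
    (1ℤ ∷ - 1ℤ ∷ []) ⊙ (1ℤ ∷ - 1ℤ ∷ []) ⊙ ehr k 1 one
      ≈⟨ Δ-⊙ ((1ℤ ∷ - 1ℤ ∷ []) ⊙ ehr k 1 one) ⟩
    Δ ((1ℤ ∷ - 1ℤ ∷ []) ⊙ ehr k 1 one)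
      ≈⟨ Δ-cong (Δ-⊙ (ehr k 1 one)) ⟩
    Δ (Δ (ehr k 1 one)) ∎
    where open ≗-Reasoning

  HstarAt-1-σ : HstarAt k 1 σ ≗ Δ (Δ⁺ (ehr k 1 σ))
  HstarAt-1-σ = begin
    HstarAt k 1 σ
      ≈⟨ polyTimesSeries-⊙ (multiplier 1 σ) (ehr k 1 σ) ⟩
    multiplier 1 σ ⊙ ehr k 1 σ
      ≈⟨ ⊙-polyMul₂ (1ℤ ∷ - 1ℤ ∷ []) (1ℤ ∷ 1ℤ ∷ []) (ehr k 1 σ) ⟩
    (1ℤ ∷ - 1ℤ ∷ []) ⊙ (1ℤ ∷ 1ℤ ∷ []) ⊙ ehr k 1 σ
      ≈⟨ Δ-⊙ ((1ℤ ∷ 1ℤ ∷ []) ⊙ ehr k 1 σ) ⟩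
    Δ ((1ℤ ∷ 1ℤ ∷ []) ⊙ ehr k 1 σ)
      ≈⟨ Δ-cong (Δ⁺-⊙ (ehr k 1 σ)) ⟩
    Δ (Δ⁺ (ehr k 1 σ)) ∎
    where open ≗-Reasoning

⌊[1+m*2]/2⌋≡m : ∀ m → ⌊ suc (m ℕ.* 2) /2⌋ ≡ m
⌊[1+m*2]/2⌋≡m zero    = refl
⌊[1+m*2]/2⌋≡m (suc m) = cong suc (⌊[1+m*2]/2⌋≡m m)

module _ (q : ℕ) where

  private
    k = suc (q ℕ.* 2)

  [k+1]/2≡1+q : (k ℕ.+ 1) ℕ./ 2 ≡ suc q
  [k+1]/2≡1+q = trans (cong (λ n → suc n ℕ./ 2) (ℕ.+-comm (q ℕ.* 2) 1)) (ℕ.m*n/n≡m (suc q) 2)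

  [k∸1]/2≡q : (k ℕ.∸ 1) ℕ./ 2 ≡ q
  [k∸1]/2≡q = ℕ.m*n/n≡m q 2

  κ-one : κ k one ≡ + k
  κ-one = begin
    c₊ k * 1ℤ + c₋ k * 1ℤ   ≡⟨ cong₂ (λ a b → + a * 1ℤ + + b * 1ℤ) [k+1]/2≡1+q [k∸1]/2≡q ⟩
    + suc q * 1ℤ + + q * 1ℤ ≡⟨ cong₂ _+_ (ℤ.*-identityʳ (+ suc q)) (ℤ.*-identityʳ (+ q)) ⟩
    + suc q + + q           ≡⟨ ℤ.pos-+ (suc q) q ⟨
    + (suc q ℕ.+ q)         ≡⟨ cong +_ (double q) ⟩
    + k                     ∎
    where
    open ≡-Reasoning
    double : ∀ q → suc q ℕ.+ q ≡ suc (q ℕ.* 2)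
    double = ℕ-Solver.solve-∀

  κ-σ : κ k σ ≡ 1ℤ
  κ-σ = begin
    c₊ k * 1ℤ + c₋ k * - 1ℤ        ≡⟨ cong₂ (λ a b → + a * 1ℤ + + b * - 1ℤ) [k+1]/2≡1+q [k∸1]/2≡q ⟩
    (1ℤ + + q) * 1ℤ + + q * - 1ℤ   ≡⟨ difference (+ q) ⟩
    1ℤ                             ∎
    where
    open ≡-Reasoning
    difference : ∀ x → (1ℤ + x) * 1ℤ + x * - 1ℤ ≡ 1ℤ
    difference = solve-∀

  ehr-1-one-1 : ehr k 1 one 1 ≡ + k
  ehr-1-one-1 = cong +_ (begin
    latticeCount k 1 one 1      ≡⟨ latticeCount-points k 0 one 1 ⟩
    suc (2 ℕ.* ⌊ k ℕ.* 1 /2⌋)   ≡⟨ cong (λ n → suc (2 ℕ.* ⌊ n /2⌋)) (ℕ.*-identityʳ k) ⟩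
    suc (2 ℕ.* ⌊ k /2⌋)         ≡⟨ cong (λ n → suc (2 ℕ.* n)) (⌊[1+m*2]/2⌋≡m q) ⟩
    suc (2 ℕ.* q)               ≡⟨ cong suc (ℕ.*-comm 2 q) ⟩
    k                           ∎)
    where open ≡-Reasoning

  HstarAt-2 : ∀ g → HstarAt k 2 g ≗ coeff (χ₁ g ∷ κ k g - χ₂ g ∷ κ k g ∷ [])
  HstarAt-2 one = begin
    HstarAt k 2 one
      ≈⟨ HstarAt-suc k 0 one ⟩
    Δ⁺ (HstarAt k 1 one)
      ≈⟨ Δ⁺-cong (HstarAt-1-one k) ⟩
    Δ⁺ (Δ (Δ (ehr k 1 one)))
      ≈⟨ Δ⁺ΔΔ-quasiLinear {F = ehr k 1 one} (ehr-1-one-0 k) ehr-1-one-1 (ehr-1-one-2+ k) ⟩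
    coeff (1ℤ ∷ + k - 1ℤ ∷ + k ∷ [])
      ≡⟨ cong (λ K → coeff (1ℤ ∷ K - 1ℤ ∷ K ∷ [])) κ-one ⟨
    coeff (1ℤ ∷ κ k one - 1ℤ ∷ κ k one ∷ []) ∎
    where open ≗-Reasoning
  HstarAt-2 σ = begin
    HstarAt k 2 σ
      ≈⟨ HstarAt-suc k 0 σ ⟩
    Δ⁺ (HstarAt k 1 σ)
      ≈⟨ Δ⁺-cong (HstarAt-1-σ k) ⟩
    Δ⁺ (Δ (Δ⁺ (ehr k 1 σ)))
      ≈⟨ Δ⁺ΔΔ⁺-const (ehr-1-σ k) ⟩
    coeff (1ℤ ∷ + 2 ∷ 1ℤ ∷ [])
      ≡⟨ cong (λ K → coeff (1ℤ ∷ K - - 1ℤ ∷ K ∷ [])) κ-σ ⟨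
    coeff (1ℤ ∷ κ k σ - - 1ℤ ∷ κ k σ ∷ []) ∎
    where open ≗-Reasoning

  HstarAt≗claimed : ∀ N g → HstarAt k (2 ℕ.+ N) g ≗ claimed k (2 ℕ.+ N) g
  HstarAt≗claimed zero    g = begin
    HstarAt k 2 g                              ≈⟨ HstarAt-2 g ⟩
    coeff (χ₁ g ∷ κ k g - χ₂ g ∷ κ k g ∷ [])   ≈⟨ claimed-2 k g ⟨
    claimed k 2 g                              ∎
    where open ≗-Reasoning
  HstarAt≗claimed (suc N) g = begin
    HstarAt k (3 ℕ.+ N) g                      ≈⟨ HstarAt-suc k (suc N) g ⟩
    Δ⁺ (HstarAt k (2 ℕ.+ N) g)                 ≈⟨ Δ⁺-cong (HstarAt≗claimed N g) ⟩
    Δ⁺ (claimed k (2 ℕ.+ N) g)                 ≈⟨ Δ⁺-claimed k N g ⟩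
    claimed k (3 ℕ.+ N) g                      ∎
    where open ≗-Reasoning

odd⇒≡1+[n/2]*2 : ∀ {n} → n % 2 ≡ 1 → n ≡ suc (n ℕ./ 2 ℕ.* 2)
odd⇒≡1+[n/2]*2 {n} n%2≡1 = trans (ℕ.m≡m%n+[m/n]*n n 2) (cong (ℕ._+ n ℕ./ 2 ℕ.* 2) n%2≡1)

proposition4p3 : (k d : ℕ) → k % 2 ≡ 1 → 2 ≤ d →
    (g : G) (n : ℕ) → HstarAt k d g n ≡ claimedAt k d g n
proposition4p3 k (suc (suc N)) k-odd (s≤s (s≤s z≤n)) g n with k ℕ./ 2 | odd⇒≡1+[n/2]*2 {k} k-odd
... | q | refl = trans (HstarAt≗claimed q N g n) (sym (claimedAt≡claimed (suc (q ℕ.* 2)) N g n))
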